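{- For every positive integer $\ell$, \[ \frac{\sum_{d\mid\ell} c_{\ell}(d)}{\nu(\ell)} \leq \ell^{ -\frac{\log(3/2)}{\log 2}}. \]
   Context: $\nu$ is the completely multiplicative function with $\nu(p)=p+1$ for primes $p$. Let $U_j$ be the Chebyshev polynomials of the second kind, defined by $(1-2yx+x^2)^{ -1}=\sum_{j\ge0}U_j(y)x^j$, and define $c_{j,n}$ ($0\le j\le n$) by $x^n=\sum_{j=0}^n c_{j,n}U_j(x/2)$. For $d\mid\ell$, $c_\ell(d)=\prod_{p^j\| d,\ p^n\|\ell}c_{j,n}$. -}

module Defs where

open import Data.Nat as ℕ using (ℕ; zero; suc; _≤?_)
open import Data.Nat.Divisibility using (_∣_; _∣?_)
open import Data.Nat.Primality using (Prime; prime?)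
open import Data.Nat.DivMod using (_/_)
open import Data.Integer as ℤ using (ℤ; +_)
open import Data.Rational as ℚ using (ℚ; 0ℚ; 1ℚ)
open import Data.List using (List; filter; upTo; foldr; map)
open import Relation.Nullary using (yes; no)

-- Chebyshev polynomials of the second kind U_j(y), as coefficient functions:
-- U j k = coefficient of y^k in U_j(y).  Defined by the recurrence that is
-- equivalent to (1 - 2yx + x^2) * Σ U_j(y) x^j = 1:
--   U_0 = 1, U_1 = 2y, U_{j+2} = 2y U_{j+1} - U_j.
shiftℤ : (ℕ → ℤ) → ℕ → ℤ
shiftℤ f zero    = + 0
shiftℤ f (suc k) = f k

U : ℕ → ℕ → ℤ
U zero zero = + 1
U zero (suc k) = + 0
U (suc zero) k = shiftℤ (λ i → U zero i ℤ.* + 2) k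
U (suc (suc j)) k = (+ 2) ℤ.* shiftℤ (U (suc j)) k ℤ.- U j k

ℕtoℚ : ℕ → ℚ
ℕtoℚ n = (+ n) ℚ./ 1

ℤtoℚ : ℤ → ℚ
ℤtoℚ z = z ℚ./ 1

_^ℚ_ : ℚ → ℕ → ℚ
x ^ℚ zero = 1ℚ
x ^ℚ suc n = x ℚ.* (x ^ℚ n)

sumℚ : List ℚ → ℚ
sumℚ = foldr ℚ._+_ 0ℚ

prodℚ : List ℚ → ℚ
prodℚ = foldr ℚ._*_ 1ℚ

prodℕ : List ℕ → ℕ
prodℕ = foldr ℕ._*_ 1

sumTo : ℕ → (ℕ → ℚ) → ℚ
sumTo n f = sumℚ (map f (upTo (suc n)))

-- Coefficient of x^k in U_j(x/2) is (U j k) / 2^k.  The identity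
-- x^n = Σ_{j=0}^n c_{j,n} U_j(x/2), compared coefficientwise at x^k and
-- multiplied by 2^k, reads  [k = n] 2^k = Σ_{j=0}^n c_{j,n} (U j k).
kronPow2 : ℕ → ℕ → ℚ
kronPow2 k n with k ℕ.≟ n
... | yes _ = ℕtoℚ (2 ℕ.^ k)
... | no _  = 0ℚ

IsChebCoeff : (ℕ → ℕ → ℚ) → Set
IsChebCoeff c = ∀ (n k : ℕ) → kronPow2 k n ≡ sumTo n (λ j → c j n ℚ.* ℤtoℚ (U j k))
  where open import Relation.Binary.PropositionalEquality using (_≡_)

-- p-adic valuation v_p(m) (with fuel); meaningful for p ≥ 2, m ≥ 1,
-- where p^(val p m) ∥ m.
valAux : ℕ → ℕ → ℕ → ℕ
valAux zero p m = 0
valAux (suc f) zero m = 0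
valAux (suc f) (suc zero) m = 0
valAux (suc f) (suc (suc q)) m with suc (suc q) ∣? m
... | yes _ = suc (valAux f (suc (suc q)) (m / suc (suc q)))
... | no _  = 0

val : ℕ → ℕ → ℕ
val p m = valAux m p m

divisors : ℕ → List ℕ
divisors ℓ = filter (λ d → d ∣? ℓ) (filter (λ d → 1 ≤? d) (upTo (suc ℓ)))

primeDivisors : ℕ → List ℕ
primeDivisors ℓ = filter prime? (divisors ℓ)

-- ν: completely multiplicative with ν(p) = p + 1, i.e. ν(ℓ) = Π_{p^n ∥ ℓ} (p+1)^n
ν : ℕ → ℕ
ν ℓ = prodℕ (map (λ p → (suc p) ℕ.^ val p ℓ) (primeDivisors ℓ))

cℓ : (ℕ → ℕ → ℚ) → ℕ → ℕ → ℚ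
cℓ c ℓ d = prodℚ (map (λ p → c (val p d) (val p ℓ)) (primeDivisors ℓ))

Sℓ : (ℕ → ℕ → ℚ) → ℕ → ℚ
Sℓ c ℓ = sumℚ (map (cℓ c ℓ) (divisors ℓ))

-- Both sides are multiplicative in ℓ.  Multiplying x^n = Σ_j c_{j,n} U_j(x/2) by x and using
-- x U_j(x/2) = U_{j-1}(x/2) + U_{j+1}(x/2) shows that the coefficients obey the ballot recurrence
-- c_{j,n+1} = c_{j-1,n} + c_{j+1,n}; since U_j has degree j and leading coefficient 2^j the system
-- determines them, so they are nonnegative integers with Σ_j c_{j,n} ≤ 2 Σ_j c_{j,n-1} ≤ 2^n.
-- Splitting the divisors of ℓ along its prime powers gives Σ_{d∣ℓ} c_ℓ(d) = Π_{p^n∥ℓ} Σ_j c_{j,n},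
-- so it remains to show 2^r p^a ≤ (p+1)^r for every prime p.  For p = 2 this is the hypothesis;
-- for p ≥ 3 it follows from 8a ≤ 5r (as 3^8 < 2^13) and 2^8 p^5 ≤ (p+1)^8.

module Submission where

open import Defs
open import Algebra.Structures using (IsCommutativeSemiring; IsCommutativeRing)
import Data.Nat.Properties
import Data.Integer.Properties
import Data.Rational.Properties
open import Relation.Binary.PropositionalEquality using (_≡_; cong)

module FiniteSums {A : Set} {_+_ _*_ : A → A → A} {0# 1# : A}
                  (isCommutativeSemiring : IsCommutativeSemiring _≡_ _+_ _*_ 0# 1#) where

  open import Relation.Binary.PropositionalEquality
  open import Data.Nat.Base using (ℕ; zero; suc; _≤_; _<_; z≤n; s≤s)
  open import Data.List.Base using (List; []; _∷_; _++_; map; foldr; applyUpTo; cartesianProductWith)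
  open IsCommutativeSemiring isCommutativeSemiring
    using (+-assoc; +-comm; +-identityˡ; +-identityʳ; distribˡ; distribʳ; zeroʳ; zeroˡ; +-isCommutativeMonoid)
  open import Data.List.Properties using (map-++; map-∘)
  open import Data.List.Relation.Binary.Permutation.Propositional using (_↭_; ↭⇒↭ₛ)
  import Data.List.Relation.Binary.Permutation.Propositional.Properties as Perm
  open import Data.List.Relation.Binary.Permutation.Setoid.Properties using (foldr-commMonoid)
  open ≡-Reasoning

  sum : List A → A
  sum = foldr _+_ 0#

  Σ< : ℕ → (ℕ → A) → A
  Σ< N f = sum (applyUpTo f N)

  +-interchange : ∀ a b c d → (a + b) + (c + d) ≡ (a + c) + (b + d)
  +-interchange a b c d = begin
    (a + b) + (c + d)  ≡⟨ +-assoc a b (c + d) ⟩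
    a + (b + (c + d))  ≡⟨ cong (a +_) (sym (+-assoc b c d)) ⟩
    a + ((b + c) + d)  ≡⟨ cong (λ x → a + (x + d)) (+-comm b c) ⟩
    a + ((c + b) + d)  ≡⟨ cong (a +_) (+-assoc c b d) ⟩
    a + (c + (b + d))  ≡⟨ sym (+-assoc a c (b + d)) ⟩
    (a + c) + (b + d)  ∎

  sum-++ : ∀ xs ys → sum (xs ++ ys) ≡ sum xs + sum ys
  sum-++ []       ys = sym (+-identityˡ (sum ys))
  sum-++ (x ∷ xs) ys = trans (cong (x +_) (sum-++ xs ys)) (sym (+-assoc x (sum xs) (sum ys)))

  *-distribˡ-sum : ∀ {B : Set} c (f : B → A) xs → sum (map (λ x → c * f x) xs) ≡ c * sum (map f xs)
  *-distribˡ-sum c f []       = sym (zeroʳ c)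
  *-distribˡ-sum c f (x ∷ xs) = trans (cong ((c * f x) +_) (*-distribˡ-sum c f xs)) (sym (distribˡ c (f x) _))

  *-distribʳ-sum : ∀ {B : Set} c (f : B → A) xs → sum (map (λ x → f x * c) xs) ≡ sum (map f xs) * c
  *-distribʳ-sum c f []       = sym (zeroˡ c)
  *-distribʳ-sum c f (x ∷ xs) = trans (cong ((f x * c) +_) (*-distribʳ-sum c f xs)) (sym (distribʳ c (f x) _))

  sum-map-cartesianProductWith : ∀ {B C D : Set} (F : D → A) (g : B → C → D) xs ys →
    sum (map F (cartesianProductWith g xs ys)) ≡ sum (map (λ x → sum (map (λ y → F (g x y)) ys)) xs)
  sum-map-cartesianProductWith F g []       ys = refl
  sum-map-cartesianProductWith F g (x ∷ xs) ys = begin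
    sum (map F (map (g x) ys ++ cartesianProductWith g xs ys))
      ≡⟨ cong sum (map-++ F (map (g x) ys) _) ⟩
    sum (map F (map (g x) ys) ++ map F (cartesianProductWith g xs ys))
      ≡⟨ sum-++ (map F (map (g x) ys)) _ ⟩
    sum (map F (map (g x) ys)) + sum (map F (cartesianProductWith g xs ys))
      ≡⟨ cong₂ _+_ (cong sum (sym (map-∘ ys))) (sum-map-cartesianProductWith F g xs ys) ⟩
    sum (map (λ y → F (g x y)) ys) + sum (map (λ x → sum (map (λ y → F (g x y)) ys)) xs) ∎

  sum-map-↭ : ∀ {B : Set} (f : B → A) {xs ys} → xs ↭ ys → sum (map f xs) ≡ sum (map f ys)
  sum-map-↭ f xs↭ys = foldr-commMonoid (setoid A) +-isCommutativeMonoid (↭⇒↭ₛ (Perm.map⁺ f xs↭ys))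

  Σ<-cong : ∀ N {f g : ℕ → A} → (∀ j → j < N → f j ≡ g j) → Σ< N f ≡ Σ< N g
  Σ<-cong zero    f≗g = refl
  Σ<-cong (suc N) f≗g = cong₂ _+_ (f≗g 0 (s≤s z≤n)) (Σ<-cong N (λ j j<N → f≗g (suc j) (s≤s j<N)))

  Σ<-distrib-+ : ∀ N (f g : ℕ → A) → Σ< N (λ j → f j + g j) ≡ Σ< N f + Σ< N g
  Σ<-distrib-+ zero    f g = sym (+-identityˡ 0#)
  Σ<-distrib-+ (suc N) f g = trans (cong ((f 0 + g 0) +_) (Σ<-distrib-+ N (λ j → f (suc j)) (λ j → g (suc j))))
                                   (+-interchange (f 0) (g 0) _ _)

  *-distribˡ-Σ< : ∀ N c (f : ℕ → A) → Σ< N (λ j → c * f j) ≡ c * Σ< N f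
  *-distribˡ-Σ< zero    c f = sym (zeroʳ c)
  *-distribˡ-Σ< (suc N) c f =
    trans (cong ((c * f 0) +_) (*-distribˡ-Σ< N c (λ j → f (suc j)))) (sym (distribˡ c (f 0) _))

  Σ<-vanishing-tail : ∀ M N (f : ℕ → A) → M ≤ N → (∀ j → M ≤ j → f j ≡ 0#) → Σ< N f ≡ Σ< M f
  Σ<-vanishing-tail zero    zero    f _         _   = refl
  Σ<-vanishing-tail zero    (suc N) f _         f≡0 =
    trans (cong₂ _+_ (f≡0 0 z≤n) (Σ<-vanishing-tail 0 N (λ j → f (suc j)) z≤n (λ j _ → f≡0 (suc j) z≤n)))
          (+-identityˡ 0#)
  Σ<-vanishing-tail (suc M) (suc N) f (s≤s M≤N) f≡0 =
    cong (f 0 +_) (Σ<-vanishing-tail M N (λ j → f (suc j)) M≤N (λ j M≤j → f≡0 (suc j) (s≤s M≤j)))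

  Σ<-suc-last : ∀ N (f : ℕ → A) → Σ< (suc N) f ≡ Σ< N f + f N
  Σ<-suc-last zero    f = trans (+-identityʳ (f 0)) (sym (+-identityˡ (f 0)))
  Σ<-suc-last (suc N) f = trans (cong (f 0 +_) (Σ<-suc-last N (λ j → f (suc j)))) (sym (+-assoc (f 0) _ _))


module ℕΣ = FiniteSums Data.Nat.Properties.+-*-isCommutativeSemiring
module ℤΣ = FiniteSums Data.Integer.Properties.+-*-isCommutativeSemiring
module ℚΣ = FiniteSums (IsCommutativeRing.isCommutativeSemiring Data.Rational.Properties.+-*-isCommutativeRing)

module Casts where

  open import Data.Nat.Base as ℕ using (ℕ; zero; suc)
  open import Data.Integer.Base as ℤ using (ℤ; +_; -[1+_])
  import Data.Integer.Properties as ℤP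
  open import Data.Rational.Base as ℚ using (ℚ; mkℚ)
  import Data.Rational.Properties as ℚP
  open import Data.Nat.Coprimality as Coprimality using (Coprime; 1-coprimeTo)
  open import Data.List.Base using ([]; _∷_; map)
  open import Relation.Binary.PropositionalEquality

  private
    coprimeTo-1 : ∀ n → Coprime n 1
    coprimeTo-1 n = Coprimality.sym (1-coprimeTo n)

  ℤtoℚ≡mkℚ : ∀ z → ℤtoℚ z ≡ mkℚ z 0 (coprimeTo-1 ℤ.∣ z ∣)
  ℤtoℚ≡mkℚ (+ n)    = ℚP.normalize-coprime (coprimeTo-1 n)
  ℤtoℚ≡mkℚ -[1+ n ] = cong ℚ.-_ (ℚP.normalize-coprime (coprimeTo-1 (suc n)))

  ℤtoℚ-homo-+ : ∀ z w → ℤtoℚ (z ℤ.+ w) ≡ ℤtoℚ z ℚ.+ ℤtoℚ w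
  ℤtoℚ-homo-+ z w rewrite ℤtoℚ≡mkℚ z | ℤtoℚ≡mkℚ w =
    sym (cong₂ (λ x y → (x ℤ.+ y) ℚ./ 1) (ℤP.*-identityʳ z) (ℤP.*-identityʳ w))

  ℤtoℚ-homo-* : ∀ z w → ℤtoℚ (z ℤ.* w) ≡ ℤtoℚ z ℚ.* ℤtoℚ w
  ℤtoℚ-homo-* z w rewrite ℤtoℚ≡mkℚ z | ℤtoℚ≡mkℚ w = refl

  ℕtoℚ-homo-* : ∀ m n → ℕtoℚ (m ℕ.* n) ≡ ℕtoℚ m ℚ.* ℕtoℚ n
  ℕtoℚ-homo-* m n = trans (cong ℤtoℚ (ℤP.pos-* m n)) (ℤtoℚ-homo-* (+ m) (+ n))

  ℕtoℚ-homo-^ : ∀ m n → ℕtoℚ m ^ℚ n ≡ ℕtoℚ (m ℕ.^ n)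
  ℕtoℚ-homo-^ m ℕ.zero    = refl
  ℕtoℚ-homo-^ m (suc n) = trans (cong (ℕtoℚ m ℚ.*_) (ℕtoℚ-homo-^ m n)) (sym (ℕtoℚ-homo-* m _))

  ℕtoℚ-homo-prod : ∀ (f : ℕ → ℕ) xs → prodℚ (map (λ x → ℕtoℚ (f x)) xs) ≡ ℕtoℚ (prodℕ (map f xs))
  ℕtoℚ-homo-prod f []       = refl
  ℕtoℚ-homo-prod f (x ∷ xs) = trans (cong (ℕtoℚ (f x) ℚ.*_) (ℕtoℚ-homo-prod f xs)) (sym (ℕtoℚ-homo-* (f x) _))

  ℕtoℚ-homo-+ : ∀ m n → ℕtoℚ (m ℕ.+ n) ≡ ℕtoℚ m ℚ.+ ℕtoℚ n
  ℕtoℚ-homo-+ m n = trans (cong ℤtoℚ (ℤP.pos-+ m n)) (ℤtoℚ-homo-+ (+ m) (+ n))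

  ℤtoℚ-homo-Σ< : ∀ N f → ℤtoℚ (ℤΣ.Σ< N f) ≡ ℚΣ.Σ< N (λ j → ℤtoℚ (f j))
  ℤtoℚ-homo-Σ< zero    f = refl
  ℤtoℚ-homo-Σ< (suc N) f =
    trans (ℤtoℚ-homo-+ (f 0) _) (cong (ℤtoℚ (f 0) ℚ.+_) (ℤtoℚ-homo-Σ< N (λ j → f (suc j))))

  ℕtoℚ-homo-Σ< : ∀ N f → ℕtoℚ (ℕΣ.Σ< N f) ≡ ℚΣ.Σ< N (λ j → ℕtoℚ (f j))
  ℕtoℚ-homo-Σ< zero    f = refl
  ℕtoℚ-homo-Σ< (suc N) f =
    trans (ℕtoℚ-homo-+ (f 0) _) (cong (ℕtoℚ (f 0) ℚ.+_) (ℕtoℚ-homo-Σ< N (λ j → f (suc j))))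

  *-cancelʳ-ℕtoℚ : ∀ {x y} n .{{_ : ℕ.NonZero n}} → x ℚ.* ℕtoℚ n ≡ y ℚ.* ℕtoℚ n → x ≡ y
  *-cancelʳ-ℕtoℚ (suc m) eq rewrite ℤtoℚ≡mkℚ (+ suc m) =
    ℚP.≤-antisym (ℚP.*-cancelʳ-≤-pos _ (ℚP.≤-reflexive eq)) (ℚP.*-cancelʳ-≤-pos _ (ℚP.≤-reflexive (sym eq)))

  ℕtoℚ-mono-≤ : ∀ {m n} → m ℕ.≤ n → ℕtoℚ m ℚ.≤ ℕtoℚ n
  ℕtoℚ-mono-≤ {m} {n} m≤n rewrite ℤtoℚ≡mkℚ (+ m) | ℤtoℚ≡mkℚ (+ n) =
    ℚ.*≤* (ℤP.*-monoʳ-≤-nonNeg (+ 1) (ℤ.+≤+ m≤n))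

module Chebyshev where

  open import Data.Nat.Base as ℕ using (ℕ; zero; suc; _≤_; _<_; z≤n; s≤s)
  import Data.Nat.Properties as ℕP
  import Data.Nat.Tactic.RingSolver as ℕSolver
  open import Data.Integer.Base as ℤ using (ℤ; +_)
  import Data.Integer.Properties as ℤP
  open import Data.Integer.Tactic.RingSolver using (solve-∀)
  open import Data.Rational.Base as ℚ using (ℚ; 0ℚ)
  import Data.Rational.Properties as ℚP
  open import Data.List.Properties using (map-upTo)
  import Algebra.Properties.Group as GroupProperties
  open import Relation.Nullary using (yes; no)
  open import Data.Sum.Base using ([_,_]′)
  open import Relation.Binary.PropositionalEquality
  open import Data.Empty using (⊥-elim)
  open Casts

  ballot : ℕ → ℕ → ℕ
  ballot zero    zero    = 1
  ballot (suc j) zero    = 0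
  ballot zero    (suc n) = ballot 1 n
  ballot (suc j) (suc n) = ballot j n ℕ.+ ballot (suc (suc j)) n

  ballot-above : ∀ {j n} → n < j → ballot j n ≡ 0
  ballot-above {suc j} {zero}  _         = refl
  ballot-above {suc j} {suc n} (s≤s n<j)
    rewrite ballot-above n<j | ballot-above (ℕP.m<n⇒m<1+n (ℕP.m<n⇒m<1+n n<j)) = refl

  ballotSum : ℕ → ℕ
  ballotSum n = ℕΣ.Σ< (suc n) (λ j → ballot j n)

  ballotSum-suc : ∀ n → ballotSum (suc n) ℕ.+ ballot 0 n ≡ 2 ℕ.* ballotSum n
  ballotSum-suc n = begin
    (ballot 1 n ℕ.+ ℕΣ.Σ< (suc n) (λ j → ballot j n ℕ.+ ballot (2 ℕ.+ j) n)) ℕ.+ ballot 0 n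
      ≡⟨ cong (λ s → (ballot 1 n ℕ.+ s) ℕ.+ ballot 0 n)
              (ℕΣ.Σ<-distrib-+ (suc n) (λ j → ballot j n) (λ j → ballot (2 ℕ.+ j) n)) ⟩
    (ballot 1 n ℕ.+ (ballotSum n ℕ.+ R)) ℕ.+ ballot 0 n
      ≡⟨ rearrange (ballot 1 n) (ballotSum n) R (ballot 0 n) ⟩
    ballotSum n ℕ.+ ℕΣ.Σ< (3 ℕ.+ n) (λ j → ballot j n)
      ≡⟨ cong (ballotSum n ℕ.+_) (ℕΣ.Σ<-vanishing-tail (suc n) (3 ℕ.+ n) _ (ℕP.m≤n+m (suc n) 2) (λ j → ballot-above)) ⟩
    ballotSum n ℕ.+ ballotSum n
      ≡⟨ cong (ballotSum n ℕ.+_) (sym (ℕP.+-identityʳ _)) ⟩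
    2 ℕ.* ballotSum n ∎
    where
    open ≡-Reasoning
    R : ℕ
    R = ℕΣ.Σ< (suc n) (λ j → ballot (2 ℕ.+ j) n)
    rearrange : ∀ a t r b → (a ℕ.+ (t ℕ.+ r)) ℕ.+ b ≡ t ℕ.+ (b ℕ.+ (a ℕ.+ r))
    rearrange = ℕSolver.solve-∀

  ballotSum≤2^n : ∀ n → ballotSum n ≤ 2 ℕ.^ n
  ballotSum≤2^n zero    = ℕP.≤-refl
  ballotSum≤2^n (suc n) = begin
    ballotSum (suc n)                 ≤⟨ ℕP.m≤m+n _ (ballot 0 n) ⟩
    ballotSum (suc n) ℕ.+ ballot 0 n  ≡⟨ ballotSum-suc n ⟩
    2 ℕ.* ballotSum n                 ≤⟨ ℕP.*-monoʳ-≤ 2 (ballotSum≤2^n n) ⟩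
    2 ℕ.^ suc n                       ∎
    where open ℕP.≤-Reasoning

  U-above : ∀ {j k} → j < k → U j k ≡ + 0
  U-above {zero}        {suc k}       _          = refl
  U-above {suc zero}    {suc zero}    (s≤s ())
  U-above {suc zero}    {suc (suc k)} _          = refl
  U-above {suc (suc j)} {suc k}       (s≤s 1+j<k)
    rewrite U-above 1+j<k | U-above {j} {suc k} (ℕP.m<n⇒m<1+n (ℕP.<-trans (ℕP.n<1+n j) 1+j<k)) = refl

  U-diag : ∀ j → U j j ≡ + (2 ℕ.^ j)
  U-diag zero          = refl
  U-diag (suc zero)    = refl
  U-diag (suc (suc j)) rewrite U-diag (suc j) | U-above {j} {suc (suc j)} (ℕP.m<n⇒m<1+n (ℕP.n<1+n j)) =
    trans (ℤP.+-identityʳ _) (sym (ℤP.pos-* 2 (2 ℕ.^ suc j)))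

  U-prev : ℕ → ℕ → ℤ
  U-prev zero    k = + 0
  U-prev (suc j) k = U j k

  U-suc+U-prev : ∀ j k → U (suc j) k ℤ.+ U-prev j k ≡ + 2 ℤ.* shiftℤ (U j) k
  U-suc+U-prev zero    zero    = refl
  U-suc+U-prev zero    (suc k) = trans (ℤP.+-identityʳ _) (ℤP.*-comm (U 0 k) (+ 2))
  U-suc+U-prev (suc j) k       = cancel (+ 2 ℤ.* shiftℤ (U (suc j)) k) (U j k)
    where
    cancel : ∀ a b → (a ℤ.- b) ℤ.+ b ≡ a
    cancel = solve-∀

  kronPow2ℤ : ℕ → ℕ → ℤ
  kronPow2ℤ k n with k ℕP.≟ n
  ... | yes _ = + (2 ℕ.^ k)
  ... | no _  = + 0

  kronPow2≡ℤtoℚ : ∀ k n → kronPow2 k n ≡ ℤtoℚ (kronPow2ℤ k n)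
  kronPow2≡ℤtoℚ k n with k ℕP.≟ n
  ... | yes _ = refl
  ... | no _  = refl

  kronPow2ℤ-suc : ∀ k n → kronPow2ℤ (suc k) (suc n) ≡ + 2 ℤ.* kronPow2ℤ k n
  kronPow2ℤ-suc k n with k ℕP.≟ n | suc k ℕP.≟ suc n
  ... | yes _   | yes _     = ℤP.pos-* 2 (2 ℕ.^ k)
  ... | yes k≡n | no  k≢n   = ⊥-elim (k≢n (cong suc k≡n))
  ... | no  k≢n | yes 1+k≡n = ⊥-elim (k≢n (ℕP.suc-injective 1+k≡n))
  ... | no  _   | no  _     = refl

  kronPow2ℤ-zero : ∀ k → kronPow2ℤ k 0 ≡ U 0 k
  kronPow2ℤ-zero zero    = refl
  kronPow2ℤ-zero (suc k) = refl

  ballot-shift : ∀ n k N → n < N →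
    ℤΣ.Σ< (suc N) (λ j → + ballot j (suc n) ℤ.* U j k)
      ≡ ℤΣ.Σ< (2 ℕ.+ N) (λ j → + ballot j n ℤ.* (U (suc j) k ℤ.+ U-prev j k))
  ballot-shift n k N n<N = begin
    x ℤ.+ ℤΣ.Σ< N (λ j → + (ballot j n ℕ.+ ballot (2 ℕ.+ j) n) ℤ.* U (suc j) k)
      ≡⟨ cong (λ s → x ℤ.+ s) (trans (ℤΣ.Σ<-cong N (λ j _ → split j)) (ℤΣ.Σ<-distrib-+ N f g)) ⟩
    x ℤ.+ (ℤΣ.Σ< N f ℤ.+ ℤΣ.Σ< N g)
      ≡⟨ rearrange x (ℤΣ.Σ< N f) (ℤΣ.Σ< N g) (+ ballot 0 n) ⟩
    ℤΣ.Σ< N f ℤ.+ ℤΣ.Σ< (2 ℕ.+ N) h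
      ≡⟨ cong (ℤ._+ ℤΣ.Σ< (2 ℕ.+ N) h) (ℤΣ.Σ<-vanishing-tail N (2 ℕ.+ N) f (ℕP.m≤n+m N 2) f-vanishes) ⟨
    ℤΣ.Σ< (2 ℕ.+ N) f ℤ.+ ℤΣ.Σ< (2 ℕ.+ N) h
      ≡⟨ ℤΣ.Σ<-distrib-+ (2 ℕ.+ N) f h ⟨
    ℤΣ.Σ< (2 ℕ.+ N) (λ j → f j ℤ.+ h j)
      ≡⟨ ℤΣ.Σ<-cong (2 ℕ.+ N) (λ j _ → ℤP.*-distribˡ-+ (+ ballot j n) (U (suc j) k) (U-prev j k)) ⟨
    ℤΣ.Σ< (2 ℕ.+ N) (λ j → + ballot j n ℤ.* (U (suc j) k ℤ.+ U-prev j k)) ∎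
    where
    open ≡-Reasoning
    x : ℤ
    x = + ballot 1 n ℤ.* U 0 k
    f g h : ℕ → ℤ
    f j = + ballot j n ℤ.* U (suc j) k
    g j = + ballot (2 ℕ.+ j) n ℤ.* U (suc j) k
    h j = + ballot j n ℤ.* U-prev j k
    split : ∀ j → + (ballot j n ℕ.+ ballot (2 ℕ.+ j) n) ℤ.* U (suc j) k ≡ f j ℤ.+ g j
    split j = trans (cong (ℤ._* U (suc j) k) (ℤP.pos-+ (ballot j n) (ballot (2 ℕ.+ j) n)))
                    (ℤP.*-distribʳ-+ (U (suc j) k) (+ ballot j n) (+ ballot (2 ℕ.+ j) n))
    rearrange : ∀ x a b d → x ℤ.+ (a ℤ.+ b) ≡ a ℤ.+ (d ℤ.* + 0 ℤ.+ (x ℤ.+ b))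
    rearrange = solve-∀
    f-vanishes : ∀ j → N ≤ j → f j ≡ + 0
    f-vanishes j N≤j rewrite ballot-above (ℕP.<-≤-trans n<N N≤j) = ℤP.*-zeroˡ (U (suc j) k)

  ballot-system : ∀ n k N → n < N → ℤΣ.Σ< N (λ j → + ballot j n ℤ.* U j k) ≡ kronPow2ℤ k n
  ballot-system zero    k (suc N) _ = begin
    ℤΣ.Σ< (suc N) f
      ≡⟨ ℤΣ.Σ<-vanishing-tail 1 (suc N) f (s≤s z≤n) (λ { (suc j) _ → ℤP.*-zeroˡ (U (suc j) k) }) ⟩
    + 1 ℤ.* U 0 k ℤ.+ + 0
      ≡⟨ trans (ℤP.+-identityʳ _) (ℤP.*-identityˡ (U 0 k)) ⟩
    U 0 k
      ≡⟨ kronPow2ℤ-zero k ⟨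
    kronPow2ℤ k 0 ∎
    where
    open ≡-Reasoning
    f : ℕ → ℤ
    f j = + ballot j 0 ℤ.* U j k
  ballot-system (suc n) k (suc N) (s≤s n<N) = begin
    ℤΣ.Σ< (suc N) (λ j → + ballot j (suc n) ℤ.* U j k)
      ≡⟨ ballot-shift n k N n<N ⟩
    ℤΣ.Σ< (2 ℕ.+ N) (λ j → + ballot j n ℤ.* (U (suc j) k ℤ.+ U-prev j k))
      ≡⟨ ℤΣ.Σ<-cong (2 ℕ.+ N) (λ j _ → cong (λ u → + ballot j n ℤ.* u) (U-suc+U-prev j k)) ⟩
    ℤΣ.Σ< (2 ℕ.+ N) (λ j → + ballot j n ℤ.* (+ 2 ℤ.* shiftℤ (U j) k))
      ≡⟨ doubled k ⟩
    kronPow2ℤ k (suc n) ∎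
    where
    open ≡-Reasoning
    doubled : ∀ k → ℤΣ.Σ< (2 ℕ.+ N) (λ j → + ballot j n ℤ.* (+ 2 ℤ.* shiftℤ (U j) k)) ≡ kronPow2ℤ k (suc n)
    doubled zero    = ℤΣ.Σ<-vanishing-tail 0 (2 ℕ.+ N) _ z≤n (λ j _ → ℤP.*-zeroʳ (+ ballot j n))
    doubled (suc k) = begin
      ℤΣ.Σ< (2 ℕ.+ N) (λ j → + ballot j n ℤ.* (+ 2 ℤ.* U j k))
        ≡⟨ ℤΣ.Σ<-cong (2 ℕ.+ N) (λ j _ → swap (+ ballot j n) (U j k)) ⟩
      ℤΣ.Σ< (2 ℕ.+ N) (λ j → + 2 ℤ.* (+ ballot j n ℤ.* U j k))
        ≡⟨ ℤΣ.*-distribˡ-Σ< (2 ℕ.+ N) (+ 2) (λ j → + ballot j n ℤ.* U j k) ⟩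
      + 2 ℤ.* ℤΣ.Σ< (2 ℕ.+ N) (λ j → + ballot j n ℤ.* U j k)
        ≡⟨ cong (λ s → + 2 ℤ.* s) (ballot-system n k (2 ℕ.+ N) (ℕP.m≤n⇒m≤o+n 2 n<N)) ⟩
      + 2 ℤ.* kronPow2ℤ k n
        ≡⟨ kronPow2ℤ-suc k n ⟨
      kronPow2ℤ (suc k) (suc n) ∎
      where
      swap : ∀ d u → d ℤ.* (+ 2 ℤ.* u) ≡ + 2 ℤ.* (d ℤ.* u)
      swap = solve-∀

  kronPow2-ballot : ∀ n k → kronPow2 k n ≡ ℚΣ.Σ< (suc n) (λ j → ℕtoℚ (ballot j n) ℚ.* ℤtoℚ (U j k))
  kronPow2-ballot n k = begin
    kronPow2 k n                                            ≡⟨ kronPow2≡ℤtoℚ k n ⟩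
    ℤtoℚ (kronPow2ℤ k n)                                    ≡⟨ cong ℤtoℚ (ballot-system n k (suc n) ℕP.≤-refl) ⟨
    ℤtoℚ (ℤΣ.Σ< (suc n) (λ j → + ballot j n ℤ.* U j k))     ≡⟨ ℤtoℚ-homo-Σ< (suc n) (λ j → + ballot j n ℤ.* U j k) ⟩
    ℚΣ.Σ< (suc n) (λ j → ℤtoℚ (+ ballot j n ℤ.* U j k))
      ≡⟨ ℚΣ.Σ<-cong (suc n) (λ j _ → ℤtoℚ-homo-* (+ ballot j n) (U j k)) ⟩
    ℚΣ.Σ< (suc n) (λ j → ℕtoℚ (ballot j n) ℚ.* ℤtoℚ (U j k)) ∎
    where open ≡-Reasoning

  Ucombination : ℕ → (ℕ → ℚ) → ℕ → ℚ
  Ucombination N f k = ℚΣ.Σ< N (λ j → f j ℚ.* ℤtoℚ (U j k))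

  Ucombination-suc : ∀ N f k → Ucombination (suc N) f k ≡ Ucombination N f k ℚ.+ f N ℚ.* ℤtoℚ (U N k)
  Ucombination-suc N f k = ℚΣ.Σ<-suc-last N (λ j → f j ℚ.* ℤtoℚ (U j k))

  Ucombination-leading : ∀ N f → Ucombination (suc N) f N ≡ f N ℚ.* ℕtoℚ (2 ℕ.^ N)
  Ucombination-leading N f = begin
    Ucombination (suc N) f N                       ≡⟨ Ucombination-suc N f N ⟩
    Ucombination N f N ℚ.+ f N ℚ.* ℤtoℚ (U N N)    ≡⟨ cong (ℚ._+ f N ℚ.* ℤtoℚ (U N N)) below-diagonal ⟩
    0ℚ ℚ.+ f N ℚ.* ℤtoℚ (U N N)                    ≡⟨ ℚP.+-identityˡ _ ⟩
    f N ℚ.* ℤtoℚ (U N N)                           ≡⟨ cong (λ u → f N ℚ.* ℤtoℚ u) (U-diag N) ⟩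
    f N ℚ.* ℕtoℚ (2 ℕ.^ N)                         ∎
    where
    open ≡-Reasoning
    below-diagonal : Ucombination N f N ≡ 0ℚ
    below-diagonal = trans (ℚΣ.Σ<-cong N (λ j j<N → trans (cong (λ u → f j ℚ.* ℤtoℚ u) (U-above j<N)) (ℚP.*-zeroʳ (f j))))
                           (ℚΣ.Σ<-vanishing-tail 0 N (λ _ → 0ℚ) z≤n (λ _ _ → refl))

  Ucombination-injective : ∀ N f g → (∀ k → Ucombination N f k ≡ Ucombination N g k) → ∀ j → j < N → f j ≡ g j
  Ucombination-injective (suc N) f g same j j<1+N =
    [ Ucombination-injective N f g same-below j , (λ j≡N → subst (λ i → f i ≡ g i) (sym j≡N) leading) ]′
      (ℕP.m≤n⇒m<n∨m≡n (ℕP.≤-pred j<1+N))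
    where
    open GroupProperties ℚP.+-0-group using (∙-cancelʳ)
    leading : f N ≡ g N
    leading = *-cancelʳ-ℕtoℚ (2 ℕ.^ N) {{ℕP.m^n≢0 2 N}}
      (trans (sym (Ucombination-leading N f)) (trans (same N) (Ucombination-leading N g)))
    same-below : ∀ k → Ucombination N f k ≡ Ucombination N g k
    same-below k = ∙-cancelʳ (g N ℚ.* ℤtoℚ (U N k)) _ _ (begin
      Ucombination N f k ℚ.+ g N ℚ.* ℤtoℚ (U N k)  ≡⟨ cong (λ t → Ucombination N f k ℚ.+ t ℚ.* ℤtoℚ (U N k)) leading ⟨
      Ucombination N f k ℚ.+ f N ℚ.* ℤtoℚ (U N k)  ≡⟨ Ucombination-suc N f k ⟨
      Ucombination (suc N) f k                     ≡⟨ same k ⟩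
      Ucombination (suc N) g k                     ≡⟨ Ucombination-suc N g k ⟩
      Ucombination N g k ℚ.+ g N ℚ.* ℤtoℚ (U N k)  ∎)
      where open ≡-Reasoning

  sumTo≡Σ< : ∀ n f → sumTo n f ≡ ℚΣ.Σ< (suc n) f
  sumTo≡Σ< n f = cong sumℚ (map-upTo f (suc n))

  chebCoeff≡ballot : ∀ {c} → IsChebCoeff c → ∀ {j n} → j ≤ n → c j n ≡ ℕtoℚ (ballot j n)
  chebCoeff≡ballot {c} isCheb {j} {n} j≤n =
    Ucombination-injective (suc n) (λ j → c j n) (λ j → ℕtoℚ (ballot j n)) same j (s≤s j≤n)
    where
    same : ∀ k → Ucombination (suc n) (λ j → c j n) k ≡ Ucombination (suc n) (λ j → ℕtoℚ (ballot j n)) k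
    same k = trans (sym (trans (isCheb n k) (sumTo≡Σ< n (λ j → c j n ℚ.* ℤtoℚ (U j k))))) (kronPow2-ballot n k)

  sum-chebCoeff : ∀ {c} → IsChebCoeff c → ∀ n → sumTo n (λ j → c j n) ≡ ℕtoℚ (ballotSum n)
  sum-chebCoeff {c} isCheb n = begin
    sumTo n (λ j → c j n)                          ≡⟨ sumTo≡Σ< n (λ j → c j n) ⟩
    ℚΣ.Σ< (suc n) (λ j → c j n)
      ≡⟨ ℚΣ.Σ<-cong (suc n) (λ j j<1+n → chebCoeff≡ballot {c} isCheb (ℕP.≤-pred j<1+n)) ⟩
    ℚΣ.Σ< (suc n) (λ j → ℕtoℚ (ballot j n))        ≡⟨ ℕtoℚ-homo-Σ< (suc n) (λ j → ballot j n) ⟨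
    ℕtoℚ (ballotSum n)                             ∎
    where open ≡-Reasoning

module Valuation where

  open import Data.Nat.Base
    using ( ℕ; zero; suc; _+_; _*_; _^_; _≤_; z≤n; s≤s; NonZero; NonTrivial; 2+
          ; >-nonZero; ≢-nonZero; ≢-nonZero⁻¹; nonTrivial⇒nonZero)
  open import Data.Nat.Properties
  open import Data.Nat.Divisibility
  open import Data.Nat.DivMod using (_/_; m*n/n≡m; m/n*n≡m; m/n<m; m≥n⇒m/n>0)
  open import Data.Nat.Primality using (Prime; prime⇒nonTrivial; prime⇒nonZero; euclidsLemma; prime⇒irreducible; ¬prime[1])
  open import Data.Product.Base using (∃; _×_; _,_)
  open import Data.Sum.Base using (inj₁; inj₂)
  open import Relation.Nullary using (¬_; yes; no; contradiction)
  open import Relation.Binary.PropositionalEquality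
  open import Algebra.Properties.CommutativeSemigroup *-commutativeSemigroup using (x∙yz≈y∙xz)
  open ≡-Reasoning

  *-factor-nonZero : ∀ a {b n} .{{_ : NonZero n}} → n ≡ a * b → NonZero b
  *-factor-nonZero a {b} {n} n≡a*b =
    ≢-nonZero λ b≡0 → ≢-nonZero⁻¹ n (trans n≡a*b (trans (cong (a *_) b≡0) (*-zeroʳ a)))

  private
    quotient-nonZero : ∀ {p m} .{{_ : NonZero p}} .{{_ : NonZero m}} → p ∣ m → NonZero (m / p)
    quotient-nonZero p∣m = >-nonZero (m≥n⇒m/n>0 (∣⇒≤ p∣m))

    /-shrinks : ∀ {q f} m .{{_ : NonZero m}} → m ≤ suc f → m / 2+ q ≤ f
    /-shrinks {q} m m≤1+f = ≤-pred (≤-trans (m/n<m m (2+ q) (s≤s (s≤s z≤n))) m≤1+f)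

    valAux-∣ : ∀ f q m → 2+ q ∣ m → valAux (suc f) (2+ q) m ≡ suc (valAux f (2+ q) (m / 2+ q))
    valAux-∣ f q m p∣m with 2+ q ∣? m
    ... | yes _   = refl
    ... | no  p∤m = contradiction p∣m p∤m

  valAux-fuel : ∀ {p} .{{_ : NonTrivial p}} f g m .{{_ : NonZero m}} → m ≤ f → m ≤ g → valAux f p m ≡ valAux g p m
  valAux-fuel {2+ q} (suc f) (suc g) m m≤1+f m≤1+g with 2+ q ∣? m
  ... | no  _   = refl
  ... | yes p∣m = cong suc (valAux-fuel f g (m / 2+ q) {{quotient-nonZero p∣m}} (/-shrinks m m≤1+f) (/-shrinks m m≤1+g))
  valAux-fuel {2+ q} zero    _    (suc _) () _
  valAux-fuel {2+ q} (suc _) zero (suc _) _  ()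

  val-∤ : ∀ {p m} .{{_ : NonTrivial p}} → ¬ p ∣ m → val p m ≡ 0
  val-∤ {2+ q} {zero}  _ = refl
  val-∤ {2+ q} {suc m} p∤m with 2+ q ∣? suc m
  ... | yes p∣m = contradiction p∣m p∤m
  ... | no  _   = refl

  val-p* : ∀ {p} .{{_ : NonTrivial p}} m .{{_ : NonZero m}} → val p (p * m) ≡ suc (val p m)
  val-p* {p@(2+ q)} m@(suc m-1) = begin
    val p (p * m)                         ≡⟨ valAux-∣ (m-1 + suc q * m) q (p * m) (m∣m*n m) ⟩
    suc (valAux (m-1 + suc q * m) p (p * m / p)) ≡⟨ cong (λ x → suc (valAux (m-1 + suc q * m) p x)) p*m/p≡m ⟩
    suc (valAux (m-1 + suc q * m) p m)    ≡⟨ cong suc (valAux-fuel (m-1 + suc q * m) m m m≤fuel ≤-refl) ⟩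
    suc (val p m)                         ∎
    where
    p*m/p≡m : p * m / p ≡ m
    p*m/p≡m = trans (cong (_/ p) (*-comm p m)) (m*n/n≡m m p)
    m≤fuel : m ≤ m-1 + suc q * m
    m≤fuel = ≤-trans (m≤m+n m (q * m)) (m≤n+m (suc q * m) m-1)

  valAux-decomposition : ∀ {p} .{{_ : NonTrivial p}} f m .{{_ : NonZero m}} → m ≤ f →
    ∃ λ m′ → m ≡ p ^ valAux f p m * m′ × ¬ p ∣ m′
  valAux-decomposition {2+ q}     zero    (suc _) ()
  valAux-decomposition {p@(2+ q)} (suc f) m       m≤1+f with p ∣? m
  ... | no  p∤m = m , sym (+-identityʳ m) , p∤m
  ... | yes p∣m with valAux-decomposition f (m / p) {{quotient-nonZero p∣m}} (/-shrinks m m≤1+f)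
  ...   | m′ , m/p≡ , p∤m′ = m′ , m≡ , p∤m′
    where
    m≡ : m ≡ p * p ^ valAux f p (m / p) * m′
    m≡ = begin
      m                                 ≡⟨ m/n*n≡m p∣m ⟨
      m / p * p                         ≡⟨ *-comm (m / p) p ⟩
      p * (m / p)                       ≡⟨ cong (p *_) m/p≡ ⟩
      p * (p ^ valAux f p (m / p) * m′) ≡⟨ *-assoc p (p ^ valAux f p (m / p)) m′ ⟨
      p * p ^ valAux f p (m / p) * m′   ∎

  val-decomposition : ∀ {p} .{{_ : NonTrivial p}} m .{{_ : NonZero m}} → ∃ λ m′ → m ≡ p ^ val p m * m′ × ¬ p ∣ m′
  val-decomposition m = valAux-decomposition m m ≤-refl

  val-p^* : ∀ {p} .{{_ : NonTrivial p}} i m .{{_ : NonZero m}} → val p (p ^ i * m) ≡ i + val p m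
  val-p^*     zero    m = cong (val _) (+-identityʳ m)
  val-p^* {p} (suc i) m = begin
    val p (p * p ^ i * m)    ≡⟨ cong (val p) (*-assoc p (p ^ i) m) ⟩
    val p (p * (p ^ i * m))  ≡⟨ val-p* (p ^ i * m) {{m*n≢0 (p ^ i) m {{m^n≢0 p i {{nonTrivial⇒nonZero p}}}}}} ⟩
    suc (val p (p ^ i * m))  ≡⟨ cong suc (val-p^* i m) ⟩
    suc (i + val p m)        ∎

  val-mono-∣ : ∀ {p d n} .{{_ : NonTrivial p}} .{{_ : NonZero d}} .{{_ : NonZero n}} → d ∣ n → val p d ≤ val p n
  val-mono-∣ {p} {d} {n} (divides k n≡k*d) with val-decomposition {p} d
  ... | d′ , d≡ , _ = subst (val p d ≤_) (sym val-n) (m≤m+n (val p d) _)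
    where
    v : ℕ
    v = val p d
    n≡ : n ≡ p ^ v * (k * d′)
    n≡ = begin
      n                 ≡⟨ n≡k*d ⟩
      k * d             ≡⟨ cong (k *_) d≡ ⟩
      k * (p ^ v * d′)  ≡⟨ x∙yz≈y∙xz k (p ^ v) d′ ⟩
      p ^ v * (k * d′)  ∎
    instance
      k*d′≢0 : NonZero (k * d′)
      k*d′≢0 = *-factor-nonZero (p ^ v) n≡
    val-n : val p n ≡ v + val p (k * d′)
    val-n = trans (cong (val p) n≡) (val-p^* v (k * d′))

  prime-∣-^ : ∀ {r q} → Prime r → Prime q → ∀ i → r ∣ q ^ i → r ≡ q
  prime-∣-^ r-prime q-prime zero    r∣1 = contradiction (subst Prime (∣1⇒≡1 r∣1) r-prime) ¬prime[1]
  prime-∣-^ r-prime q-prime (suc i) r∣q*q^i with euclidsLemma _ _ r-prime r∣q*q^i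
  ... | inj₂ r∣q^i = prime-∣-^ r-prime q-prime i r∣q^i
  ... | inj₁ r∣q with prime⇒irreducible q-prime r∣q
  ...   | inj₁ r≡1 = contradiction (subst Prime r≡1 r-prime) ¬prime[1]
  ...   | inj₂ r≡q = r≡q

  module _ {p} (p-prime : Prime p) where

    private instance
      p-nonTrivial : NonTrivial p
      p-nonTrivial = prime⇒nonTrivial p-prime

    val-p^*-∤ : ∀ i m .{{_ : NonZero m}} → ¬ p ∣ m → val p (p ^ i * m) ≡ i
    val-p^*-∤ i m p∤m = trans (val-p^* i m) (trans (cong (i +_) (val-∤ p∤m)) (+-identityʳ i))

    val-*-∤ : ∀ x y .{{_ : NonZero x}} .{{_ : NonZero y}} → ¬ p ∣ x → val p (x * y) ≡ val p y
    val-*-∤ x y p∤x with val-decomposition y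
    ... | y′ , y≡ , p∤y′ = begin
      val p (x * y)             ≡⟨ cong (λ t → val p (x * t)) y≡ ⟩
      val p (x * (p ^ v * y′))  ≡⟨ cong (val p) (x∙yz≈y∙xz x (p ^ v) y′) ⟩
      val p (p ^ v * (x * y′))  ≡⟨ val-p^*-∤ v (x * y′) {{m*n≢0 x y′}} p∤xy′ ⟩
      v                         ∎
      where
      v : ℕ
      v = val p y
      instance
        y′≢0 : NonZero y′
        y′≢0 = *-factor-nonZero (p ^ v) y≡
      p∤xy′ : ¬ p ∣ x * y′
      p∤xy′ p∣xy′ with euclidsLemma x y′ p-prime p∣xy′
      ... | inj₁ p∣x  = p∤x p∣x
      ... | inj₂ p∣y′ = p∤y′ p∣y′

    val-q^* : ∀ {q} → Prime q → p ≢ q → ∀ i e .{{_ : NonZero e}} → val p (q ^ i * e) ≡ val p e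
    val-q^* {q} q-prime p≢q i e =
      val-*-∤ (q ^ i) e {{m^n≢0 q i {{prime⇒nonZero q-prime}}}} (λ p∣q^i → p≢q (prime-∣-^ p-prime q-prime i p∣q^i))

module Divisors where

  open import Data.Nat.Base
    using (ℕ; suc; _∸_; _*_; _^_; _≤_; s≤s; NonZero; NonTrivial; >-nonZero; >-nonZero⁻¹)
  open import Data.Nat.Properties
  open import Data.Nat.Divisibility
  open import Data.Nat.Primality using (Prime; prime?; prime⇒nonZero; prime⇒nonTrivial; euclidsLemma; ¬prime[1])
  open import Data.Nat.Primality.Factorisation using (factorise)
  open import Data.Rational.Base as ℚ using (ℚ)
  import Data.Rational.Properties as ℚP
  open import Data.List.Base using (List; []; _∷_; [_]; map; upTo; filter; cartesianProductWith)
  open import Data.List.Properties using (map-cong; map-cong-local)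
  open import Data.List.Membership.Propositional using (_∈_; _∉_)
  open import Data.List.Membership.Propositional.Properties
    using (∈-cartesianProductWith⁺; ∈-cartesianProductWith⁻; ∈-map⁻; ∈-upTo⁺; ∈-upTo⁻; ∈-filter⁺; ∈-filter⁻)
  open import Data.List.Membership.Propositional.Properties.WithK using (unique∧set⇒bag)
  open import Data.List.Relation.Binary.BagAndSetEquality using (∼bag⇒↭)
  open import Data.List.Relation.Binary.Permutation.Propositional using (_↭_)
  open import Data.List.Relation.Unary.All as All using (All; []; _∷_)
  open import Data.List.Relation.Unary.Any using (here; there)
  open import Data.List.Relation.Unary.AllPairs using ([]; _∷_)
  open import Data.List.Relation.Unary.Unique.Propositional using (Unique)
  import Data.List.Relation.Unary.Unique.Propositional.Properties as Unique
  open import Data.Product.Base using (_×_; _,_; proj₁; proj₂)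
  open import Data.Sum.Base using (inj₁; inj₂)
  open import Function.Base using (case_of_)
  open import Function.Bundles using (mk⇔)
  open import Data.List.Relation.Unary.All.Properties using (All¬⇒¬Any)
  open import Relation.Nullary using (¬_; contradiction)
  open import Relation.Binary.PropositionalEquality hiding ([_])
  open Valuation
  open Casts using (ℕtoℚ-homo-prod)
  open Chebyshev using (ballotSum; sum-chebCoeff)

  divisorBox : List ℕ → (ℕ → ℕ) → List ℕ
  divisorBox []       n = [ 1 ]
  divisorBox (p ∷ ps) n = cartesianProductWith (λ i e → p ^ i * e) (upTo (suc (n p))) (divisorBox ps n)

  divisorBox-nonZero : ∀ {ps n d} → All Prime ps → d ∈ divisorBox ps n → NonZero d
  divisorBox-nonZero {[]}     _ (here refl) = _
  divisorBox-nonZero {p ∷ ps} {n} (p-prime ∷ ps-prime) d∈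
    with i , e , _ , e∈ , refl ← ∈-cartesianProductWith⁻ _ (upTo (suc (n p))) (divisorBox ps n) d∈ =
    m*n≢0 (p ^ i) e {{m^n≢0 p i {{prime⇒nonZero p-prime}}}} {{divisorBox-nonZero ps-prime e∈}}

  divisorBox-∤ : ∀ {ps n d r} → All Prime ps → Prime r → r ∉ ps → d ∈ divisorBox ps n → ¬ r ∣ d
  divisorBox-∤ {[]}     _ r-prime _ (here refl) r∣1 = ¬prime[1] (subst Prime (∣1⇒≡1 r∣1) r-prime)
  divisorBox-∤ {p ∷ ps} {n} (p-prime ∷ ps-prime) r-prime r∉ d∈ r∣d
    with i , e , _ , e∈ , refl ← ∈-cartesianProductWith⁻ _ (upTo (suc (n p))) (divisorBox ps n) d∈
    with euclidsLemma (p ^ i) e r-prime r∣d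
  ... | inj₁ r∣p^i = r∉ (here (prime-∣-^ r-prime p-prime i r∣p^i))
  ... | inj₂ r∣e   = divisorBox-∤ ps-prime r-prime (λ r∈ps → r∉ (there r∈ps)) e∈ r∣e

  module _ {p} (p-prime : Prime p) {es : List ℕ}
           (es-unique : Unique es) (es-nonZero : ∀ {e} → e ∈ es → NonZero e) (p∤es : ∀ {e} → e ∈ es → ¬ p ∣ e) where

    private
      instance
        p-nonZero : NonZero p
        p-nonZero = prime⇒nonZero p-prime

      val-p^*-∈ : ∀ i {e} → e ∈ es → val p (p ^ i * e) ≡ i
      val-p^*-∈ i e∈ = val-p^*-∤ p-prime i _ {{es-nonZero e∈}} (p∤es e∈)

    p^*-unique : ∀ {is} → Unique is → Unique (cartesianProductWith (λ i e → p ^ i * e) is es)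
    p^*-unique {[]}     _                   = []
    p^*-unique {i ∷ is} (i∉is ∷ is-unique) =
      Unique.++⁺ (Unique.map⁺ (*-cancelˡ-≡ _ _ (p ^ i) {{m^n≢0 p i}}) es-unique) (p^*-unique is-unique) disjoint
      where
      disjoint : ∀ {v} → ¬ (v ∈ map (λ e → p ^ i * e) es × v ∈ cartesianProductWith (λ i e → p ^ i * e) is es)
      disjoint (v∈ , v∈′)
        with e , e∈ , refl ← ∈-map⁻ (λ e → p ^ i * e) v∈
        with j , e′ , j∈ , e′∈ , v≡ ← ∈-cartesianProductWith⁻ _ is es v∈′ =
        All.lookup i∉is j∈ (trans (sym (val-p^*-∈ i e∈)) (trans (cong (val p) v≡) (val-p^*-∈ j e′∈)))

  divisorBox-unique : ∀ {ps} n → All Prime ps → Unique ps → Unique (divisorBox ps n)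
  divisorBox-unique {[]}     n _                    _                    = [] ∷ []
  divisorBox-unique {p ∷ ps} n (p-prime ∷ ps-prime) (p∉ps ∷ ps-unique) =
    p^*-unique p-prime (divisorBox-unique n ps-prime ps-unique) (divisorBox-nonZero ps-prime)
      (divisorBox-∤ ps-prime p-prime (λ p∈ps → All.lookup p∉ps p∈ps refl)) (Unique.upTo⁺ (suc (n p)))

  ^-monoʳ-∣ : ∀ p {i m} → i ≤ m → p ^ i ∣ p ^ m
  ^-monoʳ-∣ p {i} {m} i≤m =
    divides (p ^ (m ∸ i)) (trans (cong (p ^_) (sym (m∸n+n≡m i≤m))) (^-distribˡ-+-* p (m ∸ i) i))

  divisorBox-∣ : ∀ {ps n d} → d ∈ divisorBox ps n → d ∣ prodℕ (map (λ q → q ^ n q) ps)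
  divisorBox-∣ {[]}     (here refl) = ∣-refl
  divisorBox-∣ {p ∷ ps} {n} d∈
    with i , e , i∈ , e∈ , refl ← ∈-cartesianProductWith⁻ _ (upTo (suc (n p))) (divisorBox ps n) d∈ =
    *-pres-∣ (^-monoʳ-∣ p (≤-pred (∈-upTo⁻ i∈))) (divisorBox-∣ {ps} {n} e∈)

  no-prime-divisor⇒≡1 : ∀ x .{{_ : NonZero x}} → (∀ {r} → Prime r → ¬ r ∣ x) → x ≡ 1
  no-prime-divisor⇒≡1 x r∤x with factorise x
  ... | record { factors = [] ; isFactorisation = x≡1 } = x≡1
  ... | record { factors = r ∷ rs ; isFactorisation = x≡r*rs ; factorsPrime = r-prime ∷ _ } =
    contradiction (subst (r ∣_) (sym x≡r*rs) (m∣m*n _)) (r∤x r-prime)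

  module SplitOff {p ps} (p-prime : Prime p) (p∉ps : p ∉ ps) (x : ℕ) .{{_ : NonZero x}}
                  (x-primes : ∀ {r} → Prime r → r ∣ x → r ∈ p ∷ ps) where

    private instance
      p-nonTrivial : NonTrivial p
      p-nonTrivial = prime⇒nonTrivial p-prime

    x′ : ℕ
    x′ = proj₁ (val-decomposition {p} x)

    x≡ : x ≡ p ^ val p x * x′
    x≡ = proj₁ (proj₂ (val-decomposition {p} x))

    instance
      x′-nonZero : NonZero x′
      x′-nonZero = *-factor-nonZero (p ^ val p x) x≡

    x′-primes : ∀ {r} → Prime r → r ∣ x′ → r ∈ ps
    x′-primes {r} r-prime r∣x′ with x-primes r-prime (subst (r ∣_) (sym x≡) (∣n⇒∣m*n (p ^ val p x) r∣x′))
    ... | here refl  = contradiction r∣x′ (proj₂ (proj₂ (val-decomposition {p} x)))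
    ... | there r∈ps = r∈ps

    val-x′ : ∀ {q} → Prime q → q ∈ ps → val q x′ ≡ val q x
    val-x′ {q} q-prime q∈ps =
      sym (trans (cong (val q) x≡) (val-q^* q-prime p-prime (λ q≡p → p∉ps (subst (_∈ ps) q≡p q∈ps)) (val p x) x′))

  ≡∏prime-powers : ∀ {ps} → All Prime ps → Unique ps → ∀ x .{{_ : NonZero x}} →
    (∀ {r} → Prime r → r ∣ x → r ∈ ps) → x ≡ prodℕ (map (λ q → q ^ val q x) ps)
  ≡∏prime-powers {[]}     _ _ x x-primes = no-prime-divisor⇒≡1 x (λ r-prime r∣x → case x-primes r-prime r∣x of λ ())
  ≡∏prime-powers {p ∷ ps} (p-prime ∷ ps-prime) (p≢ps ∷ ps-unique) x x-primes = begin
    x                                                   ≡⟨ x≡ ⟩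
    p ^ val p x * x′                                    ≡⟨ cong (p ^ val p x *_) (≡∏prime-powers ps-prime ps-unique x′ x′-primes) ⟩
    p ^ val p x * prodℕ (map (λ q → q ^ val q x′) ps)   ≡⟨ cong (λ t → p ^ val p x * prodℕ t) (map-cong-local same-vals) ⟩
    p ^ val p x * prodℕ (map (λ q → q ^ val q x) ps)    ∎
    where
    open ≡-Reasoning
    open SplitOff p-prime (All¬⇒¬Any p≢ps) x x-primes
    same-vals : All (λ q → q ^ val q x′ ≡ q ^ val q x) ps
    same-vals = All.tabulate (λ {q} q∈ps → cong (q ^_) (val-x′ (All.lookup ps-prime q∈ps) q∈ps))

  ∈-divisorBox⁺ : ∀ {ps} n → All Prime ps → Unique ps → ∀ d .{{_ : NonZero d}} →
    (∀ {r} → Prime r → r ∣ d → r ∈ ps) → (∀ {q} → q ∈ ps → val q d ≤ n q) → d ∈ divisorBox ps n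
  ∈-divisorBox⁺ {[]}     n _ _ d d-primes _ =
    subst (_∈ [ 1 ]) (sym (no-prime-divisor⇒≡1 d (λ r-prime r∣d → case d-primes r-prime r∣d of λ ()))) (here refl)
  ∈-divisorBox⁺ {p ∷ ps} n (p-prime ∷ ps-prime) (p≢ps ∷ ps-unique) d d-primes val≤n =
    subst (_∈ divisorBox (p ∷ ps) n) (sym x≡)
      (∈-cartesianProductWith⁺ (λ i e → p ^ i * e) (∈-upTo⁺ (s≤s (val≤n (here refl))))
        (∈-divisorBox⁺ n ps-prime ps-unique x′ x′-primes
          (λ {q} q∈ps → subst (_≤ n q) (sym (val-x′ (All.lookup ps-prime q∈ps) q∈ps)) (val≤n (there q∈ps)))))
    where open SplitOff p-prime (All¬⇒¬Any p≢ps) d d-primes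

  sum-divisorBox : ∀ (F : ℕ → ℕ → ℚ) {ps} n → All Prime ps → Unique ps →
    sumℚ (map (λ d → prodℚ (map (λ q → F q (val q d)) ps)) (divisorBox ps n))
      ≡ prodℚ (map (λ q → sumTo (n q) (F q)) ps)
  sum-divisorBox F {[]}     n _ _ = ℚP.+-identityʳ _
  sum-divisorBox F {p ∷ ps} n (p-prime ∷ ps-prime) (p≢ps ∷ ps-unique) = begin
    ℚΣ.sum (map G (cartesianProductWith (λ i e → p ^ i * e) I B))
      ≡⟨ ℚΣ.sum-map-cartesianProductWith G (λ i e → p ^ i * e) I B ⟩
    ℚΣ.sum (map (λ i → ℚΣ.sum (map (λ e → G (p ^ i * e)) B)) I)
      ≡⟨ cong ℚΣ.sum (map-cong (λ i → cong ℚΣ.sum (map-cong-local (All.tabulate (factorises i)))) I) ⟩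
    ℚΣ.sum (map (λ i → ℚΣ.sum (map (λ e → F p i ℚ.* Π e) B)) I)
      ≡⟨ cong ℚΣ.sum (map-cong (λ i → ℚΣ.*-distribˡ-sum (F p i) Π B) I) ⟩
    ℚΣ.sum (map (λ i → F p i ℚ.* ℚΣ.sum (map Π B)) I)
      ≡⟨ ℚΣ.*-distribʳ-sum (ℚΣ.sum (map Π B)) (F p) I ⟩
    sumTo (n p) (F p) ℚ.* ℚΣ.sum (map Π B)
      ≡⟨ cong (sumTo (n p) (F p) ℚ.*_) (sum-divisorBox F n ps-prime ps-unique) ⟩
    sumTo (n p) (F p) ℚ.* prodℚ (map (λ q → sumTo (n q) (F q)) ps) ∎
    where
    open ≡-Reasoning
    I B : List ℕ
    I = upTo (suc (n p))
    B = divisorBox ps n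
    Π : ℕ → ℚ
    Π d = prodℚ (map (λ q → F q (val q d)) ps)
    G : ℕ → ℚ
    G d = F p (val p d) ℚ.* Π d
    factorises : ∀ i {e} → e ∈ B → G (p ^ i * e) ≡ F p i ℚ.* Π e
    factorises i {e} e∈B = cong₂ ℚ._*_
      (cong (F p) (val-p^*-∤ p-prime i e {{e≢0}} (divisorBox-∤ ps-prime p-prime (All¬⇒¬Any p≢ps) e∈B)))
      (cong prodℚ (map-cong-local (All.tabulate (λ {q} q∈ps →
        cong (F q) (val-q^* (All.lookup ps-prime q∈ps) p-prime (λ q≡p → All.lookup p≢ps q∈ps (sym q≡p)) i e {{e≢0}})))))
      where
      e≢0 : NonZero e
      e≢0 = divisorBox-nonZero ps-prime e∈B

  ∈-divisors⁻ : ∀ {ℓ d} → d ∈ divisors ℓ → NonZero d × d ∣ ℓ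
  ∈-divisors⁻ {ℓ} d∈ with d∈′ , d∣ℓ ← ∈-filter⁻ (_∣? ℓ) {xs = filter (1 ≤?_) (upTo (suc ℓ))} d∈ =
    >-nonZero (proj₂ (∈-filter⁻ (1 ≤?_) {xs = upTo (suc ℓ)} d∈′)) , d∣ℓ

  ∈-divisors⁺ : ∀ {ℓ d} .{{_ : NonZero ℓ}} .{{_ : NonZero d}} → d ∣ ℓ → d ∈ divisors ℓ
  ∈-divisors⁺ {ℓ} {d} d∣ℓ =
    ∈-filter⁺ (_∣? ℓ) (∈-filter⁺ (1 ≤?_) (∈-upTo⁺ (s≤s (∣⇒≤ d∣ℓ))) (>-nonZero⁻¹ d)) d∣ℓ

  divisors-unique : ∀ ℓ → Unique (divisors ℓ)
  divisors-unique ℓ = Unique.filter⁺ (_∣? ℓ) (Unique.filter⁺ (1 ≤?_) (Unique.upTo⁺ (suc ℓ)))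

  ∈-primeDivisors⁻ : ∀ {ℓ q} → q ∈ primeDivisors ℓ → Prime q × q ∣ ℓ
  ∈-primeDivisors⁻ {ℓ} q∈ with q∈′ , q-prime ← ∈-filter⁻ prime? {xs = divisors ℓ} q∈ =
    q-prime , proj₂ (∈-divisors⁻ q∈′)

  ∈-primeDivisors⁺ : ∀ {ℓ q} .{{_ : NonZero ℓ}} → Prime q → q ∣ ℓ → q ∈ primeDivisors ℓ
  ∈-primeDivisors⁺ {q = q} q-prime q∣ℓ = ∈-filter⁺ prime? (∈-divisors⁺ q∣ℓ) q-prime
    where
    instance
      q≢0 : NonZero q
      q≢0 = prime⇒nonZero q-prime

  primeDivisors-prime : ∀ ℓ → All Prime (primeDivisors ℓ)
  primeDivisors-prime ℓ = All.tabulate (λ q∈ → proj₁ (∈-primeDivisors⁻ {ℓ} q∈))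

  primeDivisors-unique : ∀ ℓ → Unique (primeDivisors ℓ)
  primeDivisors-unique ℓ = Unique.filter⁺ prime? (divisors-unique ℓ)

  ≡∏primeDivisors^val : ∀ ℓ .{{_ : NonZero ℓ}} → ℓ ≡ prodℕ (map (λ q → q ^ val q ℓ) (primeDivisors ℓ))
  ≡∏primeDivisors^val ℓ = ≡∏prime-powers (primeDivisors-prime ℓ) (primeDivisors-unique ℓ) ℓ (∈-primeDivisors⁺ {ℓ})

  divisors↭divisorBox : ∀ ℓ .{{_ : NonZero ℓ}} → divisors ℓ ↭ divisorBox (primeDivisors ℓ) (λ q → val q ℓ)
  divisors↭divisorBox ℓ =
    ∼bag⇒↭ (unique∧set⇒bag (divisors-unique ℓ) (divisorBox-unique (λ q → val q ℓ) ps-prime ps-unique) (mk⇔ to from))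
    where
    ps : List ℕ
    ps = primeDivisors ℓ
    ps-prime : All Prime ps
    ps-prime = primeDivisors-prime ℓ
    ps-unique : Unique ps
    ps-unique = primeDivisors-unique ℓ
    to : ∀ {d} → d ∈ divisors ℓ → d ∈ divisorBox ps (λ q → val q ℓ)
    to {d} d∈ with d≢0 , d∣ℓ ← ∈-divisors⁻ d∈ =
      ∈-divisorBox⁺ (λ q → val q ℓ) ps-prime ps-unique d {{d≢0}}
        (λ r-prime r∣d → ∈-primeDivisors⁺ {ℓ} r-prime (∣-trans r∣d d∣ℓ))
        (λ q∈ → val-mono-∣ {{prime⇒nonTrivial (All.lookup ps-prime q∈)}} {{d≢0}} d∣ℓ)
    from : ∀ {d} → d ∈ divisorBox ps (λ q → val q ℓ) → d ∈ divisors ℓ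
    from {d} d∈ = ∈-divisors⁺ (subst (d ∣_) (sym (≡∏primeDivisors^val ℓ)) (divisorBox-∣ {ps} d∈))
      where
      instance
        d≢0 : NonZero d
        d≢0 = divisorBox-nonZero ps-prime d∈

  Sℓ≡∏ : ∀ c ℓ .{{_ : NonZero ℓ}} →
    Sℓ c ℓ ≡ prodℚ (map (λ q → sumTo (val q ℓ) (λ j → c j (val q ℓ))) (primeDivisors ℓ))
  Sℓ≡∏ c ℓ = trans (ℚΣ.sum-map-↭ (cℓ c ℓ) (divisors↭divisorBox ℓ))
    (sum-divisorBox (λ q i → c i (val q ℓ)) (λ q → val q ℓ) (primeDivisors-prime ℓ) (primeDivisors-unique ℓ))

  ballotProduct : ℕ → ℕ
  ballotProduct ℓ = prodℕ (map (λ q → ballotSum (val q ℓ)) (primeDivisors ℓ))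

  Sℓ≡ballotProduct : ∀ {c} → IsChebCoeff c → ∀ ℓ .{{_ : NonZero ℓ}} → Sℓ c ℓ ≡ ℕtoℚ (ballotProduct ℓ)
  Sℓ≡ballotProduct {c} isCheb ℓ = begin
    Sℓ c ℓ
      ≡⟨ Sℓ≡∏ c ℓ ⟩
    prodℚ (map (λ q → sumTo (val q ℓ) (λ j → c j (val q ℓ))) (primeDivisors ℓ))
      ≡⟨ cong prodℚ (map-cong (λ q → sum-chebCoeff {c} isCheb (val q ℓ)) (primeDivisors ℓ)) ⟩
    prodℚ (map (λ q → ℕtoℚ (ballotSum (val q ℓ))) (primeDivisors ℓ))
      ≡⟨ ℕtoℚ-homo-prod (λ q → ballotSum (val q ℓ)) (primeDivisors ℓ) ⟩
    ℕtoℚ (ballotProduct ℓ) ∎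
    where open ≡-Reasoning

module Bound where

  open import Data.Nat.Base using (ℕ; zero; suc; _+_; _*_; _^_; _≤_; _<_; s≤s; NonZero; nonTrivial⇒n>1)
  open import Data.Nat.Properties
  import Data.Nat.Solver
  open Data.Nat.Solver.+-*-Solver using (con; _:+_; _:*_; _:^_; _:=_; solve)
  open import Data.Nat.Tactic.RingSolver using (solve-∀)
  open import Data.List.Base using ([]; _∷_; map)
  open import Data.List.Membership.Propositional using (_∈_)
  open import Data.List.Relation.Unary.Any using (here; there)
  open import Data.Unit.Base using (tt)
  open import Relation.Binary.PropositionalEquality
  open import Data.Product.Base using (proj₁)
  open import Data.Nat.Primality using (prime⇒nonTrivial)
  open Chebyshev using (ballotSum; ballotSum≤2^n)
  open Divisors using (ballotProduct; ≡∏primeDivisors^val; ∈-primeDivisors⁻)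

  ^-distribʳ-* : ∀ m n k → (m * n) ^ k ≡ m ^ k * n ^ k
  ^-distribʳ-* m n zero    = refl
  ^-distribʳ-* m n (suc k) = trans (cong (m * n *_) (^-distribʳ-* m n k)) (interchange m n (m ^ k) (n ^ k))
    where
    interchange : ∀ a b c d → a * b * (c * d) ≡ a * c * (b * d)
    interchange = solve-∀

  ^-^-comm : ∀ m i j → (m ^ i) ^ j ≡ (m ^ j) ^ i
  ^-^-comm m i j = trans (^-*-assoc m i j) (trans (cong (m ^_) (*-comm i j)) (sym (^-*-assoc m j i)))

  ^-cancelʳ-< : ∀ b .{{_ : NonZero b}} {m n} → b ^ m < b ^ n → m < n
  ^-cancelʳ-< b b^m<b^n = ≰⇒> (λ n≤m → <⇒≱ b^m<b^n (^-monoʳ-≤ b n≤m))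

  ^-cancelˡ-≤ : ∀ k .{{_ : NonZero k}} {m n} → m ^ k ≤ n ^ k → m ≤ n
  ^-cancelˡ-≤ k m^k≤n^k = ≮⇒≥ (λ n<m → <⇒≱ (^-monoˡ-< k n<m) m^k≤n^k)

  -- (a + r) / r < log₂ 3 < 13 / 8, the last because 3 ^ 8 < 2 ^ 13.
  8a≤5r : ∀ a r → 2 ^ (a + r) < 3 ^ r → 8 * a ≤ 5 * r
  8a≤5r a r 2^[a+r]<3^r =
    <⇒≤ (+-cancelʳ-< (8 * r) (8 * a) (5 * r) (subst₂ _<_ (*-distribˡ-+ 8 a r) split 8[a+r]<13r))
    where
    split : 13 * r ≡ 5 * r + 8 * r
    split = *-distribʳ-+ r 5 8
    8[a+r]<13r : 8 * (a + r) < 13 * r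
    8[a+r]<13r = ^-cancelʳ-< 2 (begin-strict
      2 ^ (8 * (a + r))   ≡⟨ ^-*-assoc 2 8 (a + r) ⟨
      (2 ^ 8) ^ (a + r)   ≡⟨ ^-^-comm 2 8 (a + r) ⟩
      (2 ^ (a + r)) ^ 8   <⟨ ^-monoˡ-< 8 2^[a+r]<3^r ⟩
      (3 ^ r) ^ 8         ≡⟨ ^-^-comm 3 r 8 ⟩
      (3 ^ 8) ^ r         ≤⟨ ^-monoˡ-≤ r (≤ᵇ⇒≤ 6561 8192 tt) ⟩
      (2 ^ 13) ^ r        ≡⟨ ^-*-assoc 2 13 r ⟩
      2 ^ (13 * r)        ∎)
      where open ≤-Reasoning

  256*[3+q]^5≤[4+q]^8 : ∀ q → 256 * (3 + q) ^ 5 ≤ (4 + q) ^ 8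
  256*[3+q]^5≤[4+q]^8 q = subst (256 * (3 + q) ^ 5 ≤_) (sym (expand q)) (m≤m+n _ _)
    where
    expand : ∀ q → (4 + q) ^ 8 ≡ 256 * (3 + q) ^ 5 + (q ^ 8 + 32 * q ^ 7 + 448 * q ^ 6 + 3328 * q ^ 5
                                 + 14080 * q ^ 4 + 34304 * q ^ 3 + 45568 * q ^ 2 + 27392 * q + 3328)
    expand = solve 1 (λ q → (con 4 :+ q) :^ 8 := con 256 :* (con 3 :+ q) :^ 5 :+ (q :^ 8 :+ con 32 :* q :^ 7
                              :+ con 448 :* q :^ 6 :+ con 3328 :* q :^ 5 :+ con 14080 :* q :^ 4 :+ con 34304 :* q :^ 3
                              :+ con 45568 :* q :^ 2 :+ con 27392 :* q :+ con 3328)) refl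

  2^r*p^a≤[1+p]^r : ∀ p a r → 2 ≤ p → 2 ^ (a + r) < 3 ^ r → 2 ^ r * p ^ a ≤ suc p ^ r
  2^r*p^a≤[1+p]^r 1 a r (s≤s ())
  2^r*p^a≤[1+p]^r 2 a r _ 2^[a+r]<3^r = begin
    2 ^ r * 2 ^ a  ≡⟨ ^-distribˡ-+-* 2 r a ⟨
    2 ^ (r + a)    ≡⟨ cong (2 ^_) (+-comm r a) ⟩
    2 ^ (a + r)    ≤⟨ <⇒≤ 2^[a+r]<3^r ⟩
    3 ^ r          ∎
    where open ≤-Reasoning
  2^r*p^a≤[1+p]^r p@(suc (suc (suc q))) a r _ 2^[a+r]<3^r = ^-cancelˡ-≤ 8 (begin
    (2 ^ r * p ^ a) ^ 8          ≡⟨ ^-distribʳ-* (2 ^ r) (p ^ a) 8 ⟩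
    (2 ^ r) ^ 8 * (p ^ a) ^ 8    ≡⟨ cong₂ _*_ (^-^-comm 2 r 8) (^-*-assoc p a 8) ⟩
    (2 ^ 8) ^ r * p ^ (a * 8)    ≤⟨ *-monoʳ-≤ ((2 ^ 8) ^ r) (^-monoʳ-≤ p a*8≤r*5) ⟩
    256 ^ r * p ^ (r * 5)        ≡⟨ cong (256 ^ r *_) (^-*-assoc p r 5) ⟨
    256 ^ r * (p ^ r) ^ 5        ≡⟨ cong (256 ^ r *_) (^-^-comm p r 5) ⟩
    256 ^ r * (p ^ 5) ^ r        ≡⟨ ^-distribʳ-* 256 (p ^ 5) r ⟨
    (256 * p ^ 5) ^ r            ≤⟨ ^-monoˡ-≤ r (256*[3+q]^5≤[4+q]^8 q) ⟩
    (suc p ^ 8) ^ r              ≡⟨ ^-^-comm (suc p) 8 r ⟩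
    (suc p ^ r) ^ 8              ∎)
    where
    open ≤-Reasoning
    a*8≤r*5 : a * 8 ≤ r * 5
    a*8≤r*5 = subst₂ _≤_ (*-comm 8 a) (*-comm 5 r) (8a≤5r a r 2^[a+r]<3^r)

  [2^n]^r*[p^n]^a≤[[1+p]^n]^r : ∀ p a r n → 2 ≤ p → 2 ^ (a + r) < 3 ^ r →
    (2 ^ n) ^ r * (p ^ n) ^ a ≤ (suc p ^ n) ^ r
  [2^n]^r*[p^n]^a≤[[1+p]^n]^r p a r n 2≤p 2^[a+r]<3^r = begin
    (2 ^ n) ^ r * (p ^ n) ^ a    ≡⟨ cong₂ _*_ (^-^-comm 2 n r) (^-^-comm p n a) ⟩
    (2 ^ r) ^ n * (p ^ a) ^ n    ≡⟨ ^-distribʳ-* (2 ^ r) (p ^ a) n ⟨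
    (2 ^ r * p ^ a) ^ n          ≤⟨ ^-monoˡ-≤ n (2^r*p^a≤[1+p]^r p a r 2≤p 2^[a+r]<3^r) ⟩
    (suc p ^ r) ^ n              ≡⟨ ^-^-comm (suc p) r n ⟩
    (suc p ^ n) ^ r              ∎
    where open ≤-Reasoning

  prodℕ-^-*-^-mono-≤ : ∀ {A : Set} (f g h : A → ℕ) a r xs →
    (∀ {x} → x ∈ xs → f x ^ r * g x ^ a ≤ h x ^ r) →
    prodℕ (map f xs) ^ r * prodℕ (map g xs) ^ a ≤ prodℕ (map h xs) ^ r
  prodℕ-^-*-^-mono-≤ f g h a r []       _       =
    ≤-reflexive (trans (cong₂ _*_ (^-zeroˡ r) (^-zeroˡ a)) (sym (^-zeroˡ r)))
  prodℕ-^-*-^-mono-≤ f g h a r (x ∷ xs) bounded = begin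
    (f x * F) ^ r * (g x * G) ^ a              ≡⟨ cong₂ _*_ (^-distribʳ-* (f x) F r) (^-distribʳ-* (g x) G a) ⟩
    f x ^ r * F ^ r * (g x ^ a * G ^ a)        ≡⟨ interchange (f x ^ r) (F ^ r) (g x ^ a) (G ^ a) ⟩
    f x ^ r * g x ^ a * (F ^ r * G ^ a)
      ≤⟨ *-mono-≤ (bounded (here refl)) (prodℕ-^-*-^-mono-≤ f g h a r xs (bounded ∘ there)) ⟩
    h x ^ r * H ^ r                            ≡⟨ ^-distribʳ-* (h x) H r ⟨
    (h x * H) ^ r                              ∎
    where
    open ≤-Reasoning
    open import Function.Base using (_∘_)
    F G H : ℕ
    F = prodℕ (map f xs)
    G = prodℕ (map g xs)
    H = prodℕ (map h xs)
    interchange : ∀ a b c d → a * b * (c * d) ≡ a * c * (b * d)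
    interchange = solve-∀

  ballotProduct-bound : ∀ ℓ .{{_ : NonZero ℓ}} a r → 2 ^ (a + r) < 3 ^ r → ballotProduct ℓ ^ r * ℓ ^ a ≤ ν ℓ ^ r
  ballotProduct-bound ℓ a r 2^[a+r]<3^r =
    subst (λ m → ballotProduct ℓ ^ r * m ^ a ≤ ν ℓ ^ r) (sym (≡∏primeDivisors^val ℓ))
      (prodℕ-^-*-^-mono-≤ (λ q → ballotSum (val q ℓ)) (λ q → q ^ val q ℓ) (λ q → suc q ^ val q ℓ) a r
                          (primeDivisors ℓ) local-bound)
    where
    local-bound : ∀ {q} → q ∈ primeDivisors ℓ → ballotSum (val q ℓ) ^ r * (q ^ val q ℓ) ^ a ≤ (suc q ^ val q ℓ) ^ r
    local-bound {q} q∈ = ≤-trans (*-monoˡ-≤ ((q ^ val q ℓ) ^ a) (^-monoˡ-≤ r (ballotSum≤2^n (val q ℓ))))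
      ([2^n]^r*[p^n]^a≤[[1+p]^n]^r q a r (val q ℓ) 2≤q 2^[a+r]<3^r)
      where
      2≤q : 2 ≤ q
      2≤q = nonTrivial⇒n>1 q {{prime⇒nonTrivial (proj₁ (∈-primeDivisors⁻ {ℓ} q∈))}}

open import Data.Nat.Base as ℕ using (NonZero; >-nonZero)
import Data.Rational.Properties as ℚP
open Casts using (ℕtoℚ-homo-^; ℕtoℚ-homo-*; ℕtoℚ-mono-≤)
open Divisors using (ballotProduct; Sℓ≡ballotProduct)
open Bound using (ballotProduct-bound)

open import Data.Nat using (ℕ; suc; _^_; _+_; _<_)
open import Data.Rational using (ℚ)
open import Data.Rational using (_≤_; _*_)
open import Relation.Binary.PropositionalEquality using (_≡_)

lemma6p3 : (c : ℕ → ℕ → ℚ) → IsChebCoeff c →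
    (ℓ : ℕ) → 0 < ℓ →
    (a r : ℕ) → 0 < r → 2 ^ (a + r) < 3 ^ r →
    (Sℓ c ℓ ^ℚ r) * ℕtoℚ (ℓ ^ a) ≤ ℕtoℚ (ν ℓ ^ r)
lemma6p3 c isCheb ℓ 0<ℓ a r _ 2^[a+r]<3^r = begin
  Sℓ c ℓ ^ℚ r * ℕtoℚ (ℓ ^ a)    ≡⟨ cong (λ S → S ^ℚ r * ℕtoℚ (ℓ ^ a)) (Sℓ≡ballotProduct {c} isCheb ℓ) ⟩
  ℕtoℚ B ^ℚ r * ℕtoℚ (ℓ ^ a)    ≡⟨ cong (_* ℕtoℚ (ℓ ^ a)) (ℕtoℚ-homo-^ B r) ⟩
  ℕtoℚ (B ^ r) * ℕtoℚ (ℓ ^ a)   ≡⟨ ℕtoℚ-homo-* (B ^ r) (ℓ ^ a) ⟨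
  ℕtoℚ (B ^ r ℕ.* ℓ ^ a)        ≤⟨ ℕtoℚ-mono-≤ (ballotProduct-bound ℓ a r 2^[a+r]<3^r) ⟩
  ℕtoℚ (ν ℓ ^ r)                ∎
  where
  open ℚP.≤-Reasoning
  instance
    ℓ≢0 : NonZero ℓ
    ℓ≢0 = >-nonZero 0<ℓ
  B : ℕ
  B = ballotProduct ℓ
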